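{- For any two terms $t,u:\Gamma\vdash A$ of IKC, the problem whether $\Gamma\vdash t\approx u:A$ is decidable; that is, constructively, for all $t,u$ either $t\approx u$ or $\neg(t\approx u)$.
   Context: Syntax of IKC. Types $A,B ::= \iota\mid A\Rightarrow B\mid\Box A$. Contexts $\Gamma ::= \cdot\mid\Gamma,A\mid\Gamma,\blacksquare$ (snoc lists; $\blacksquare$ a lock). Variables: $\mathsf{zero}:(\Gamma,A)\vdash_{var}A$; $\mathsf{succ}\,v:(\Gamma,B)\vdash_{var}A$ for $v:\Gamma\vdash_{var}A$. OPEs: $\mathsf{base}:\cdot\le\cdot$; $\mathsf{drop}\,o:\Gamma\le(\Gamma',A)$, $\mathsf{keep}\,o:(\Gamma,A)\le(\Gamma',A)$, $\mathsf{keep}_\blacksquare\,o:(\Gamma,\blacksquare)\le(\Gamma',\blacksquare)$; identity $\mathsf{id}$. Accessibility: $\mathsf{nil}:\Gamma\lhd(\Gamma,\blacksquare)$; $\mathsf{ext}\,e:\Delta\lhd(\Gamma,A)$ for $e:\Delta\lhd\Gamma$. Terms: $\mathsf{var}\,v$; $\lambda t$; $\mathsf{app}(t,u)$; $\Gamma\vdash\mathsf{box}\,t:\Box A$ for $(\Gamma,\blacksquare)\vdash t:A$; $\Gamma\vdash\mathsf{unbox}(t,e):A$ for $\Delta\vdash t:\Box A$, $e:\Delta\lhd\Gamma$. Weakening $\mathsf{wk}(o,t)$ by structural recursion (factoring $o$ through $e$ at $\mathsf{unbox}$). Substitutions: $\mathsf{empty}$, $(s,t)$, $\mathsf{lock}(s,e):\Gamma\vdash_{sub}(\Delta,\blacksquare)$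 for $s:\Theta\vdash_{sub}\Delta$, $e:\Theta\lhd\Gamma$; $t[s]$ standard action, $\mathsf{id}_s$ identity. $\mathsf{factor}\,\mathsf{nil}=\mathsf{keep}_\blacksquare\mathsf{id}$, $\mathsf{factor}(\mathsf{ext}\,e)=\mathsf{drop}(\mathsf{factor}\,e)$. Equivalence $\approx$: least congruence containing $\mathsf{app}(\lambda t,u)\approx t[(\mathsf{id}_s,u)]$; $t\approx\lambda\,\mathsf{app}(\mathsf{wk}(\mathsf{drop}\,\mathsf{id},t),\mathsf{var}\,\mathsf{zero})$; $\mathsf{unbox}(\mathsf{box}\,t,e)\approx\mathsf{wk}(\mathsf{factor}\,e,t)$; $t\approx\mathsf{box}(\mathsf{unbox}(t,\mathsf{nil}))$. -}

module Defs where

open import Data.Product using (Σ; _×_; _,_)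

data Ty : Set where
  ι   : Ty
  _⇒_ : Ty → Ty → Ty
  □_  : Ty → Ty

infixr 7 _⇒_

data Ctx : Set where
  ·    : Ctx
  _`,_ : Ctx → Ty → Ctx
  _,🔒 : Ctx → Ctx

infixl 6 _`,_

data _∋_ : Ctx → Ty → Set where
  zero : ∀ {Γ A} → (Γ `, A) ∋ A
  succ : ∀ {Γ A B} → Γ ∋ A → (Γ `, B) ∋ A

data _≤_ : Ctx → Ctx → Set where
  base  : · ≤ ·
  drop  : ∀ {Γ Δ A} → Γ ≤ Δ → (Γ `, A) ≤ Δ
  keep  : ∀ {Γ Δ A} → Γ ≤ Δ → (Γ `, A) ≤ (Δ `, A)
  keep🔒 : ∀ {Γ Δ} → Γ ≤ Δ → (Γ ,🔒) ≤ (Δ ,🔒)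

idOPE : ∀ {Γ} → Γ ≤ Γ
idOPE {·} = base
idOPE {Γ `, A} = keep idOPE
idOPE {Γ ,🔒} = keep🔒 idOPE

data _◁_ : Ctx → Ctx → Set where
  nil : ∀ {Γ} → Γ ◁ (Γ ,🔒)
  ext : ∀ {Δ Γ A} → Δ ◁ Γ → Δ ◁ (Γ `, A)

data _⊢_ : Ctx → Ty → Set where
  var   : ∀ {Γ A} → Γ ∋ A → Γ ⊢ A
  lam   : ∀ {Γ A B} → (Γ `, A) ⊢ B → Γ ⊢ (A ⇒ B)
  app   : ∀ {Γ A B} → Γ ⊢ (A ⇒ B) → Γ ⊢ A → Γ ⊢ B
  box   : ∀ {Γ A} → (Γ ,🔒) ⊢ A → Γ ⊢ (□ A)
  unbox : ∀ {Γ Δ A} → Δ ⊢ (□ A) → Δ ◁ Γ → Γ ⊢ A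

wkVar : ∀ {Γ Δ A} → Γ ≤ Δ → Δ ∋ A → Γ ∋ A
wkVar (drop o) v = succ (wkVar o v)
wkVar (keep o) zero = zero
wkVar (keep o) (succ v) = succ (wkVar o v)

record FactorOPE (Γ' Δ : Ctx) : Set where
  constructor fct
  field
    {Δ'} : Ctx
    acc  : Δ' ◁ Γ'
    ope  : Δ' ≤ Δ

factorOPE : ∀ {Γ' Γ Δ} → Γ' ≤ Γ → Δ ◁ Γ → FactorOPE Γ' Δ
factorOPE (drop o) e with factorOPE o e
... | fct e' o' = fct (ext e') o'
factorOPE (keep o) (ext e) with factorOPE o e
... | fct e' o' = fct (ext e') o'
factorOPE (keep🔒 o) nil = fct nil o

wk : ∀ {Γ Δ A} → Γ ≤ Δ → Δ ⊢ A → Γ ⊢ A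
wk o (var v) = var (wkVar o v)
wk o (lam t) = lam (wk (keep o) t)
wk o (app t u) = app (wk o t) (wk o u)
wk o (box t) = box (wk (keep🔒 o) t)
wk o (unbox t e) with factorOPE o e
... | fct e' o' = unbox (wk o' t) e'

data _⊢s_ : Ctx → Ctx → Set where
  empty : ∀ {Γ} → Γ ⊢s ·
  _▸_   : ∀ {Γ Δ A} → Γ ⊢s Δ → Γ ⊢ A → Γ ⊢s (Δ `, A)
  lock  : ∀ {Θ Γ Δ} → Θ ⊢s Δ → Θ ◁ Γ → Γ ⊢s (Δ ,🔒)

wkSub : ∀ {Γ' Γ Δ} → Γ' ≤ Γ → Γ ⊢s Δ → Γ' ⊢s Δ
wkSub o empty = empty
wkSub o (s ▸ t) = wkSub o s ▸ wk o t
wkSub o (lock s e) with factorOPE o e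
... | fct e' o' = lock (wkSub o' s) e'

idSub : ∀ {Γ} → Γ ⊢s Γ
idSub {·} = empty
idSub {Γ `, A} = wkSub (drop idOPE) idSub ▸ var zero
idSub {Γ ,🔒} = lock idSub nil

substVar : ∀ {Γ Δ A} → Δ ∋ A → Γ ⊢s Δ → Γ ⊢ A
substVar zero (s ▸ t) = t
substVar (succ v) (s ▸ t) = substVar v s

record FactorSub (Γ Δ : Ctx) : Set where
  constructor fcs
  field
    {Θ} : Ctx
    acc : Θ ◁ Γ
    sub : Θ ⊢s Δ

factorSub : ∀ {Γ Γ' Δ} → Γ ⊢s Γ' → Δ ◁ Γ' → FactorSub Γ Δ
factorSub (lock s e) nil = fcs e s
factorSub (s ▸ t) (ext e) = factorSub s e

_[_] : ∀ {Γ Δ A} → Δ ⊢ A → Γ ⊢s Δ → Γ ⊢ A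
var v [ s ] = substVar v s
lam t [ s ] = lam (t [ wkSub (drop idOPE) s ▸ var zero ])
app t u [ s ] = app (t [ s ]) (u [ s ])
box t [ s ] = box (t [ lock s nil ])
unbox t e [ s ] with factorSub s e
... | fcs e' s' = unbox (t [ s' ]) e'

factor : ∀ {Δ Γ} → Δ ◁ Γ → Γ ≤ (Δ ,🔒)
factor nil = keep🔒 idOPE
factor (ext e) = drop (factor e)

data _≈_ : ∀ {Γ A} → Γ ⊢ A → Γ ⊢ A → Set where
  ⇒-β : ∀ {Γ A B} (t : (Γ `, A) ⊢ B) (u : Γ ⊢ A) →
        app (lam t) u ≈ (t [ idSub ▸ u ])
  ⇒-η : ∀ {Γ A B} (t : Γ ⊢ (A ⇒ B)) →
        t ≈ lam (app (wk (drop idOPE) t) (var zero))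
  □-β : ∀ {Γ Δ A} (t : (Δ ,🔒) ⊢ A) (e : Δ ◁ Γ) →
        unbox (box t) e ≈ wk (factor e) t
  □-η : ∀ {Γ A} (t : Γ ⊢ (□ A)) →
        t ≈ box (unbox t nil)
  ≈-refl  : ∀ {Γ A} {t : Γ ⊢ A} → t ≈ t
  ≈-sym   : ∀ {Γ A} {t u : Γ ⊢ A} → t ≈ u → u ≈ t
  ≈-trans : ∀ {Γ A} {t u v : Γ ⊢ A} → t ≈ u → u ≈ v → t ≈ v
  cong-lam   : ∀ {Γ A B} {t t' : (Γ `, A) ⊢ B} → t ≈ t' → lam t ≈ lam t'
  cong-app   : ∀ {Γ A B} {t t' : Γ ⊢ (A ⇒ B)} {u u' : Γ ⊢ A} →
               t ≈ t' → u ≈ u' → app t u ≈ app t' u'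
  cong-box   : ∀ {Γ A} {t t' : (Γ ,🔒) ⊢ A} → t ≈ t' → box t ≈ box t'
  cong-unbox : ∀ {Γ Δ A} {t t' : Δ ⊢ (□ A)} {e : Δ ◁ Γ} →
               t ≈ t' → unbox t e ≈ unbox t' e

{-# OPTIONS --safe #-}
-- Normalisation by evaluation. Terms are evaluated in a Kripke model over order-preserving
-- embeddings, in which ⟦ □ A ⟧ Γ = ⟦ A ⟧ (Γ ,🔒) and environments for a locked context Δ ,🔒
-- carry an accessibility witness Θ ◁ Γ; reification reads back a β-short η-long normal form.
-- Equivalent terms get equal normal forms because evaluation respects a partial equivalence
-- relation on the model that validates every rule of ≈ (a function value must commute with
-- weakening, so that evaluation is natural in the context and the η-rule for ⇒ holds).
-- Conversely every term is equivalent to its normal form by a Kripke logical relation between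
-- terms and values. Equivalence is thus decided by comparing normal forms, whose equality is
-- decidable.
module Submission where

open import Defs
open import Relation.Nullary using (Dec; yes; no)
open import Relation.Nullary.Decidable using (map′; _×-dec_)
open import Relation.Binary.PropositionalEquality hiding ([_]; cong-app)
open import Data.Product using (_×_; _,_; proj₁; proj₂)
open import Data.Unit using (⊤; tt)
open import Level using (0ℓ)
open import Relation.Binary.Bundles using (PartialSetoid)
import Relation.Binary.Reasoning.PartialSetoid
open FactorOPE
open FactorSub

infixr 9 _∙_
_∙_ : ∀ {Γ Δ Θ} → Γ ≤ Δ → Δ ≤ Θ → Γ ≤ Θ
base ∙ base = base
drop o ∙ o' = drop (o ∙ o')
keep o ∙ drop o' = drop (o ∙ o')
keep o ∙ keep o' = keep (o ∙ o')
keep🔒 o ∙ keep🔒 o' = keep🔒 (o ∙ o')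

∙-identityˡ : ∀ {Γ Δ} (o : Γ ≤ Δ) → idOPE ∙ o ≡ o
∙-identityˡ base = refl
∙-identityˡ (drop o) = cong drop (∙-identityˡ o)
∙-identityˡ (keep o) = cong keep (∙-identityˡ o)
∙-identityˡ (keep🔒 o) = cong keep🔒 (∙-identityˡ o)

∙-identityʳ : ∀ {Γ Δ} (o : Γ ≤ Δ) → o ∙ idOPE ≡ o
∙-identityʳ base = refl
∙-identityʳ (drop o) = cong drop (∙-identityʳ o)
∙-identityʳ (keep o) = cong keep (∙-identityʳ o)
∙-identityʳ (keep🔒 o) = cong keep🔒 (∙-identityʳ o)

∙-identity-swap : ∀ {Γ Δ} (o : Γ ≤ Δ) → o ∙ idOPE ≡ idOPE ∙ o
∙-identity-swap o = trans (∙-identityʳ o) (sym (∙-identityˡ o))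

∙-assoc : ∀ {Γ Δ Θ Ξ} (o : Γ ≤ Δ) (o' : Δ ≤ Θ) (o'' : Θ ≤ Ξ) → (o ∙ o') ∙ o'' ≡ o ∙ (o' ∙ o'')
∙-assoc base base base = refl
∙-assoc (drop o) o' o'' = cong drop (∙-assoc o o' o'')
∙-assoc (keep o) (drop o') o'' = cong drop (∙-assoc o o' o'')
∙-assoc (keep o) (keep o') (drop o'') = cong drop (∙-assoc o o' o'')
∙-assoc (keep o) (keep o') (keep o'') = cong keep (∙-assoc o o' o'')
∙-assoc (keep🔒 o) (keep🔒 o') (keep🔒 o'') = cong keep🔒 (∙-assoc o o' o'')

wkVar-id : ∀ {Γ A} (v : Γ ∋ A) → wkVar idOPE v ≡ v
wkVar-id zero = refl
wkVar-id (succ v) = cong succ (wkVar-id v)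

wkVar-∙ : ∀ {Γ Δ Θ A} (o : Γ ≤ Δ) (o' : Δ ≤ Θ) (v : Θ ∋ A) → wkVar (o ∙ o') v ≡ wkVar o (wkVar o' v)
wkVar-∙ (drop o) o' v = cong succ (wkVar-∙ o o' v)
wkVar-∙ (keep o) (drop o') v = cong succ (wkVar-∙ o o' v)
wkVar-∙ (keep o) (keep o') zero = refl
wkVar-∙ (keep o) (keep o') (succ v) = cong succ (wkVar-∙ o o' v)
wkVar-∙ base base ()
wkVar-∙ (keep🔒 o) (keep🔒 o') ()

keep∙drop : ∀ {Γ Δ A} (o : Γ ≤ Δ) → keep {A = A} o ∙ drop idOPE ≡ drop idOPE ∙ o
keep∙drop o = cong drop (∙-identity-swap o)

factorOPE-id : ∀ {Γ Δ} (e : Δ ◁ Γ) → factorOPE idOPE e ≡ fct e idOPE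
factorOPE-id nil = refl
factorOPE-id (ext e) rewrite factorOPE-id e = refl

factorOPE-∙ : ∀ {Γ Γ' Γ'' Δ} (o : Γ'' ≤ Γ') (o' : Γ' ≤ Γ) (e : Δ ◁ Γ) →
  factorOPE (o ∙ o') e ≡ fct (acc (factorOPE o (acc (factorOPE o' e))))
                             (ope (factorOPE o (acc (factorOPE o' e))) ∙ ope (factorOPE o' e))
factorOPE-∙ (drop o) o' e rewrite factorOPE-∙ o o' e = refl
factorOPE-∙ (keep o) (drop o') e rewrite factorOPE-∙ o o' e = refl
factorOPE-∙ (keep o) (keep o') (ext e) rewrite factorOPE-∙ o o' e = refl
factorOPE-∙ (keep🔒 o) (keep🔒 o') nil = refl
factorOPE-∙ base base ()

factor-natural : ∀ {Γ Γ' Δ} (o : Γ' ≤ Γ) (e : Δ ◁ Γ) →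
  o ∙ factor e ≡ factor (acc (factorOPE o e)) ∙ keep🔒 (ope (factorOPE o e))
factor-natural (drop o) e = cong drop (factor-natural o e)
factor-natural (keep o) (ext e) = cong drop (factor-natural o e)
factor-natural (keep🔒 o) nil = cong keep🔒 (∙-identity-swap o)

factorOPE-factor : ∀ {Γ Δ} (e : Δ ◁ Γ) → factorOPE (factor e) nil ≡ fct e idOPE
factorOPE-factor nil = refl
factorOPE-factor (ext e) rewrite factorOPE-factor e = refl

-- Weakening and substitution

wk-id : ∀ {Γ A} (t : Γ ⊢ A) → wk idOPE t ≡ t
wk-id (var v) = cong var (wkVar-id v)
wk-id (lam t) = cong lam (wk-id t)
wk-id (app t u) = cong₂ app (wk-id t) (wk-id u)
wk-id (box t) = cong box (wk-id t)
wk-id (unbox t e) rewrite factorOPE-id e = cong (λ x → unbox x e) (wk-id t)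

wk-∙ : ∀ {Γ Δ Θ A} (o : Γ ≤ Δ) (o' : Δ ≤ Θ) (t : Θ ⊢ A) → wk (o ∙ o') t ≡ wk o (wk o' t)
wk-∙ o o' (var v) = cong var (wkVar-∙ o o' v)
wk-∙ o o' (lam t) = cong lam (wk-∙ (keep o) (keep o') t)
wk-∙ o o' (app t u) = cong₂ app (wk-∙ o o' t) (wk-∙ o o' u)
wk-∙ o o' (box t) = cong box (wk-∙ (keep🔒 o) (keep🔒 o') t)
wk-∙ o o' (unbox t e) rewrite factorOPE-∙ o o' e =
  cong (λ x → unbox x _) (wk-∙ (ope (factorOPE o (acc (factorOPE o' e)))) (ope (factorOPE o' e)) t)

wk-drop-comm : ∀ {Γ Δ A B} (o : Γ ≤ Δ) (t : Δ ⊢ A) →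
  wk (drop {A = B} idOPE) (wk o t) ≡ wk (keep o) (wk (drop idOPE) t)
wk-drop-comm o t = begin
  wk (drop idOPE) (wk o t)     ≡⟨ wk-∙ (drop idOPE) o t ⟨
  wk (drop idOPE ∙ o) t        ≡⟨ cong (λ o' → wk o' t) (keep∙drop o) ⟨
  wk (keep o ∙ drop idOPE) t   ≡⟨ wk-∙ (keep o) (drop idOPE) t ⟩
  wk (keep o) (wk (drop idOPE) t) ∎
  where open ≡-Reasoning

wkSub-id : ∀ {Γ Δ} (s : Γ ⊢s Δ) → wkSub idOPE s ≡ s
wkSub-id empty = refl
wkSub-id (s ▸ t) = cong₂ _▸_ (wkSub-id s) (wk-id t)
wkSub-id (lock s e) rewrite factorOPE-id e = cong (λ x → lock x e) (wkSub-id s)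

wkSub-∙ : ∀ {Γ Γ' Γ'' Δ} (o : Γ'' ≤ Γ') (o' : Γ' ≤ Γ) (s : Γ ⊢s Δ) →
  wkSub (o ∙ o') s ≡ wkSub o (wkSub o' s)
wkSub-∙ o o' empty = refl
wkSub-∙ o o' (s ▸ t) = cong₂ _▸_ (wkSub-∙ o o' s) (wk-∙ o o' t)
wkSub-∙ o o' (lock s e) rewrite factorOPE-∙ o o' e =
  cong (λ x → lock x _) (wkSub-∙ (ope (factorOPE o (acc (factorOPE o' e)))) (ope (factorOPE o' e)) s)

substVar-wkSub : ∀ {Γ Γ' Δ A} (o : Γ' ≤ Γ) (v : Δ ∋ A) (s : Γ ⊢s Δ) →
  substVar v (wkSub o s) ≡ wk o (substVar v s)
substVar-wkSub o zero (s ▸ t) = refl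
substVar-wkSub o (succ v) (s ▸ t) = substVar-wkSub o v s

factorSub-wkSub : ∀ {Γ Γ' Δ Δ'} (o : Γ' ≤ Γ) (s : Γ ⊢s Δ) (e : Δ' ◁ Δ) →
  factorSub (wkSub o s) e ≡ fcs (acc (factorOPE o (acc (factorSub s e))))
                                (wkSub (ope (factorOPE o (acc (factorSub s e)))) (sub (factorSub s e)))
factorSub-wkSub o (lock s e') nil = refl
factorSub-wkSub o (s ▸ t) (ext e) = factorSub-wkSub o s e

infix 30 _↑
_↑ : ∀ {Γ Δ A} → Γ ⊢s Δ → (Γ `, A) ⊢s Δ
s ↑ = wkSub (drop idOPE) s

↑-wkSub : ∀ {Γ Γ' Δ A} (o : Γ' ≤ Γ) (s : Γ ⊢s Δ) → wkSub (keep {A = A} o) (s ↑) ≡ (wkSub o s) ↑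
↑-wkSub o s = begin
  wkSub (keep o) (wkSub (drop idOPE) s)   ≡⟨ wkSub-∙ (keep o) (drop idOPE) s ⟨
  wkSub (keep o ∙ drop idOPE) s           ≡⟨ cong (λ o' → wkSub o' s) (keep∙drop o) ⟩
  wkSub (drop idOPE ∙ o) s                ≡⟨ wkSub-∙ (drop idOPE) o s ⟩
  wkSub (drop idOPE) (wkSub o s)          ∎
  where open ≡-Reasoning

wk-sub : ∀ {Γ Γ' Δ A} (o : Γ' ≤ Γ) (t : Δ ⊢ A) (s : Γ ⊢s Δ) → wk o (t [ s ]) ≡ t [ wkSub o s ]
wk-sub o (var v) s = sym (substVar-wkSub o v s)
wk-sub o (lam t) s = cong lam (trans (wk-sub (keep o) t (s ↑ ▸ var zero))
                                     (cong (λ x → t [ x ▸ var zero ]) (↑-wkSub o s)))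
wk-sub o (app t u) s = cong₂ app (wk-sub o t s) (wk-sub o u s)
wk-sub o (box t) s = cong box (wk-sub (keep🔒 o) t (lock s nil))
wk-sub o (unbox t e) s rewrite factorSub-wkSub o s e =
  cong (λ x → unbox x _) (wk-sub (ope (factorOPE o (acc (factorSub s e)))) t (sub (factorSub s e)))

infixl 8 _⊙_
_⊙_ : ∀ {Γ Δ Δ'} → Γ ⊢s Δ → Δ ≤ Δ' → Γ ⊢s Δ'
s ⊙ base = empty
(s ▸ t) ⊙ drop o = s ⊙ o
(s ▸ t) ⊙ keep o = (s ⊙ o) ▸ t
lock s e ⊙ keep🔒 o = lock (s ⊙ o) e

⊙-identityʳ : ∀ {Γ Δ} (s : Γ ⊢s Δ) → s ⊙ idOPE ≡ s
⊙-identityʳ empty = refl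
⊙-identityʳ (s ▸ t) = cong (_▸ t) (⊙-identityʳ s)
⊙-identityʳ (lock s e) = cong (λ x → lock x e) (⊙-identityʳ s)

substVar-⊙ : ∀ {Γ Δ Δ' A} (o : Δ ≤ Δ') (v : Δ' ∋ A) (s : Γ ⊢s Δ) →
  substVar (wkVar o v) s ≡ substVar v (s ⊙ o)
substVar-⊙ (drop o) v (s ▸ t) = substVar-⊙ o v s
substVar-⊙ (keep o) zero (s ▸ t) = refl
substVar-⊙ (keep o) (succ v) (s ▸ t) = substVar-⊙ o v s

factorSub-⊙ : ∀ {Γ Δ Δ' Ξ} (o : Δ ≤ Δ') (s : Γ ⊢s Δ) (e : Ξ ◁ Δ') →
  factorSub (s ⊙ o) e ≡ fcs (acc (factorSub s (acc (factorOPE o e))))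
                            (sub (factorSub s (acc (factorOPE o e))) ⊙ ope (factorOPE o e))
factorSub-⊙ (drop o) (s ▸ t) e = factorSub-⊙ o s e
factorSub-⊙ (keep o) (s ▸ t) (ext e) = factorSub-⊙ o s e
factorSub-⊙ (keep🔒 o) (lock s e') nil = refl

wkSub-⊙ : ∀ {Γ Γ' Δ Δ'} (o' : Γ' ≤ Γ) (s : Γ ⊢s Δ) (o : Δ ≤ Δ') → wkSub o' (s ⊙ o) ≡ wkSub o' s ⊙ o
wkSub-⊙ o' s base = refl
wkSub-⊙ o' (s ▸ t) (drop o) = wkSub-⊙ o' s o
wkSub-⊙ o' (s ▸ t) (keep o) = cong (_▸ _) (wkSub-⊙ o' s o)
wkSub-⊙ o' (lock s e) (keep🔒 o) = cong (λ x → lock x _) (wkSub-⊙ _ s o)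

sub-wk : ∀ {Γ Δ Δ' A} (o : Δ ≤ Δ') (t : Δ' ⊢ A) (s : Γ ⊢s Δ) → wk o t [ s ] ≡ t [ s ⊙ o ]
sub-wk o (var v) s = substVar-⊙ o v s
sub-wk o (lam t) s = cong lam (trans (sub-wk (keep o) t (s ↑ ▸ var zero))
                                     (cong (λ x → t [ x ▸ var zero ]) (sym (wkSub-⊙ (drop idOPE) s o))))
sub-wk o (app t u) s = cong₂ app (sub-wk o t s) (sub-wk o u s)
sub-wk o (box t) s = cong box (sub-wk (keep🔒 o) t (lock s nil))
sub-wk o (unbox t e) s rewrite factorSub-⊙ o s e =
  cong (λ x → unbox x _) (sub-wk (ope (factorOPE o e)) t (sub (factorSub s (acc (factorOPE o e)))))

infixr 8 _∘s_
_∘s_ : ∀ {Γ Θ Δ} → Θ ⊢s Δ → Γ ⊢s Θ → Γ ⊢s Δ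
empty ∘s s' = empty
(s ▸ t) ∘s s' = (s ∘s s') ▸ (t [ s' ])
lock s e ∘s s' = lock (s ∘s sub (factorSub s' e)) (acc (factorSub s' e))

substVar-∘s : ∀ {Γ Θ Δ A} (v : Δ ∋ A) (s : Θ ⊢s Δ) (s' : Γ ⊢s Θ) →
  substVar v (s ∘s s') ≡ substVar v s [ s' ]
substVar-∘s zero (s ▸ t) s' = refl
substVar-∘s (succ v) (s ▸ t) s' = substVar-∘s v s s'

factorSub-∘s : ∀ {Γ Θ Δ Ξ} (s : Θ ⊢s Δ) (s' : Γ ⊢s Θ) (e : Ξ ◁ Δ) →
  factorSub (s ∘s s') e ≡ fcs (acc (factorSub s' (acc (factorSub s e))))
                              (sub (factorSub s e) ∘s sub (factorSub s' (acc (factorSub s e))))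
factorSub-∘s (lock s e') s' nil = refl
factorSub-∘s (s ▸ t) s' (ext e) = factorSub-∘s s s' e

wkSub-∘sˡ : ∀ {Γ Θ Θ' Δ} (o : Θ' ≤ Θ) (s : Θ ⊢s Δ) (s' : Γ ⊢s Θ') → wkSub o s ∘s s' ≡ s ∘s (s' ⊙ o)
wkSub-∘sˡ o empty s' = refl
wkSub-∘sˡ o (s ▸ t) s' = cong₂ _▸_ (wkSub-∘sˡ o s s') (sub-wk o t s')
wkSub-∘sˡ o (lock s e) s' rewrite factorSub-⊙ o s' e =
  cong (λ x → lock x _) (wkSub-∘sˡ (ope (factorOPE o e)) s (sub (factorSub s' (acc (factorOPE o e)))))

wkSub-∘sʳ : ∀ {Γ Γ' Θ Δ} (o : Γ' ≤ Γ) (s : Θ ⊢s Δ) (s' : Γ ⊢s Θ) →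
  wkSub o (s ∘s s') ≡ s ∘s wkSub o s'
wkSub-∘sʳ o empty s' = refl
wkSub-∘sʳ o (s ▸ t) s' = cong₂ _▸_ (wkSub-∘sʳ o s s') (wk-sub o t s')
wkSub-∘sʳ o (lock s e) s' rewrite factorSub-wkSub o s' e =
  cong (λ x → lock x _) (wkSub-∘sʳ (ope (factorOPE o (acc (factorSub s' e)))) s (sub (factorSub s' e)))

↑-∘s : ∀ {Γ Θ Δ A} (s : Θ ⊢s Δ) (s' : Γ ⊢s Θ) → s ↑ ∘s (s' ↑ ▸ var {A = A} zero) ≡ (s ∘s s') ↑
↑-∘s s s' = begin
  s ↑ ∘s (s' ↑ ▸ var zero)   ≡⟨ wkSub-∘sˡ (drop idOPE) s _ ⟩
  s ∘s (s' ↑ ⊙ idOPE)        ≡⟨ cong (s ∘s_) (⊙-identityʳ (s' ↑)) ⟩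
  s ∘s s' ↑                  ≡⟨ wkSub-∘sʳ (drop idOPE) s s' ⟨
  (s ∘s s') ↑                ∎
  where open ≡-Reasoning

sub-sub : ∀ {Γ Θ Δ A} (t : Δ ⊢ A) (s : Θ ⊢s Δ) (s' : Γ ⊢s Θ) → t [ s ] [ s' ] ≡ t [ s ∘s s' ]
sub-sub (var v) s s' = sym (substVar-∘s v s s')
sub-sub (lam t) s s' = cong lam (trans (sub-sub t _ _) (cong (λ x → t [ x ▸ var zero ]) (↑-∘s s s')))
sub-sub (app t u) s s' = cong₂ app (sub-sub t s s') (sub-sub u s s')
sub-sub (box t) s s' = cong box (sub-sub t (lock s nil) (lock s' nil))
sub-sub (unbox t e) s s' rewrite factorSub-∘s s s' e =
  cong (λ x → unbox x _) (sub-sub t (sub (factorSub s e)) (sub (factorSub s' (acc (factorSub s e)))))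

substVar-id : ∀ {Γ A} (v : Γ ∋ A) → substVar v idSub ≡ var v
substVar-id zero = refl
substVar-id (succ v) = begin
  substVar v (idSub ↑)                ≡⟨ substVar-wkSub (drop idOPE) v idSub ⟩
  wk (drop idOPE) (substVar v idSub)  ≡⟨ cong (wk (drop idOPE)) (substVar-id v) ⟩
  var (succ (wkVar idOPE v))          ≡⟨ cong (λ w → var (succ w)) (wkVar-id v) ⟩
  var (succ v)                        ∎
  where open ≡-Reasoning

factorSub-id : ∀ {Γ Δ} (e : Δ ◁ Γ) → factorSub idSub e ≡ fcs e idSub
factorSub-id nil = refl
factorSub-id {Γ `, A} {Δ} (ext e) = trans (factorSub-wkSub (drop idOPE) idSub e) (drop-factor (factorSub-id e))
  where
  drop-factor : {f : FactorSub Γ Δ} → f ≡ fcs e idSub →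
    fcs {Γ `, A} (ext (acc (factorOPE idOPE (acc f)))) (wkSub (ope (factorOPE idOPE (acc f))) (sub f)) ≡ fcs (ext e) idSub
  drop-factor refl rewrite factorOPE-id e = cong (fcs (ext e)) (wkSub-id idSub)

sub-id : ∀ {Γ A} (t : Γ ⊢ A) → t [ idSub ] ≡ t
sub-id (var v) = substVar-id v
sub-id (lam t) = cong lam (sub-id t)
sub-id (app t u) = cong₂ app (sub-id t) (sub-id u)
sub-id (box t) = cong box (sub-id t)
sub-id (unbox t e) rewrite factorSub-id e = cong (λ x → unbox x e) (sub-id t)

∘s-identityʳ : ∀ {Γ Δ} (s : Γ ⊢s Δ) → s ∘s idSub ≡ s
∘s-identityʳ empty = refl
∘s-identityʳ (s ▸ t) = cong₂ _▸_ (∘s-identityʳ s) (sub-id t)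
∘s-identityʳ (lock s e) rewrite factorSub-id e = cong (λ x → lock x e) (∘s-identityʳ s)

mutual
  idSub-⊙ : ∀ {Γ Δ} (o : Γ ≤ Δ) → idSub ⊙ o ≡ wkSub o idSub
  idSub-⊙ base = refl
  idSub-⊙ (drop o) = idSub-↑-⊙ o
  idSub-⊙ (keep o) = cong (_▸ var zero) (begin
    idSub ↑ ⊙ o                        ≡⟨ idSub-↑-⊙ o ⟩
    wkSub (drop o) idSub               ≡⟨ cong (λ o' → wkSub (drop o') idSub) (∙-identityʳ o) ⟨
    wkSub (keep o ∙ drop idOPE) idSub  ≡⟨ wkSub-∙ (keep o) (drop idOPE) idSub ⟩
    wkSub (keep o) (idSub ↑)           ∎)
    where open ≡-Reasoning
  idSub-⊙ (keep🔒 o) = cong (λ x → lock x nil) (idSub-⊙ o)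

  idSub-↑-⊙ : ∀ {Γ Δ A} (o : Γ ≤ Δ) → idSub ↑ ⊙ o ≡ wkSub (drop {A = A} o) idSub
  idSub-↑-⊙ o = begin
    idSub ↑ ⊙ o                         ≡⟨ wkSub-⊙ (drop idOPE) idSub o ⟨
    (idSub ⊙ o) ↑                       ≡⟨ cong _↑ (idSub-⊙ o) ⟩
    wkSub (drop idOPE) (wkSub o idSub)  ≡⟨ wkSub-∙ (drop idOPE) o idSub ⟨
    wkSub (drop idOPE ∙ o) idSub        ≡⟨ cong (λ o' → wkSub (drop o') idSub) (∙-identityˡ o) ⟩
    wkSub (drop o) idSub                ∎
    where open ≡-Reasoning

≡⇒≈ : ∀ {Γ A} {t u : Γ ⊢ A} → t ≡ u → t ≈ u
≡⇒≈ refl = ≈-refl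

wk-sub-single : ∀ {Γ Δ A B} (o : Γ ≤ Δ) (t : (Δ `, A) ⊢ B) (u : Δ ⊢ A) →
  wk (keep o) t [ idSub ▸ wk o u ] ≡ wk o (t [ idSub ▸ u ])
wk-sub-single o t u = begin
  wk (keep o) t [ idSub ▸ wk o u ]   ≡⟨ sub-wk (keep o) t _ ⟩
  t [ (idSub ⊙ o) ▸ wk o u ]         ≡⟨ cong (λ s → t [ s ▸ wk o u ]) (idSub-⊙ o) ⟩
  t [ wkSub o idSub ▸ wk o u ]       ≡⟨ wk-sub o t (idSub ▸ u) ⟨
  wk o (t [ idSub ▸ u ])             ∎
  where open ≡-Reasoning

wk-factor-natural : ∀ {Γ Γ' Δ A} (o : Γ' ≤ Γ) (e : Δ ◁ Γ) (t : (Δ ,🔒) ⊢ A) →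
  wk (factor (acc (factorOPE o e))) (wk (keep🔒 (ope (factorOPE o e))) t) ≡ wk o (wk (factor e) t)
wk-factor-natural o e t = begin
  wk (factor (acc (factorOPE o e))) (wk (keep🔒 (ope (factorOPE o e))) t)
    ≡⟨ wk-∙ _ _ t ⟨
  wk (factor (acc (factorOPE o e)) ∙ keep🔒 (ope (factorOPE o e))) t
    ≡⟨ cong (λ o' → wk o' t) (factor-natural o e) ⟨
  wk (o ∙ factor e) t
    ≡⟨ wk-∙ o (factor e) t ⟩
  wk o (wk (factor e) t)
    ∎
  where open ≡-Reasoning

≈-wk : ∀ {Γ Δ A} (o : Γ ≤ Δ) {t u : Δ ⊢ A} → t ≈ u → wk o t ≈ wk o u
≈-wk o (⇒-β t u) = ≈-trans (⇒-β _ _) (≡⇒≈ (wk-sub-single o t u))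
≈-wk o (⇒-η t) = ≈-trans (⇒-η _) (≡⇒≈ (cong (λ x → lam (app x (var zero))) (wk-drop-comm o t)))
≈-wk o (□-β t e) = ≈-trans (□-β _ _) (≡⇒≈ (wk-factor-natural o e t))
≈-wk o (□-η t) = □-η _
≈-wk o ≈-refl = ≈-refl
≈-wk o (≈-sym p) = ≈-sym (≈-wk o p)
≈-wk o (≈-trans p q) = ≈-trans (≈-wk o p) (≈-wk o q)
≈-wk o (cong-lam p) = cong-lam (≈-wk (keep o) p)
≈-wk o (cong-app p q) = cong-app (≈-wk o p) (≈-wk o q)
≈-wk o (cong-box p) = cong-box (≈-wk (keep🔒 o) p)
≈-wk o (cong-unbox p) = cong-unbox (≈-wk _ p)

β-wk-sub : ∀ {Γ Γ' Δ A B} (o : Γ' ≤ Γ) (t : (Δ `, A) ⊢ B) (s : Γ ⊢s Δ) (u : Γ' ⊢ A) →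
  app (wk o (lam t [ s ])) u ≈ (t [ wkSub o s ▸ u ])
β-wk-sub o t s u = ≈-trans (⇒-β _ u) (≡⇒≈ (begin
  wk (keep o) (t [ s ↑ ▸ var zero ]) [ idSub ▸ u ]
    ≡⟨ cong (_[ idSub ▸ u ]) (wk-sub (keep o) t (s ↑ ▸ var zero)) ⟩
  t [ wkSub (keep o) (s ↑) ▸ var zero ] [ idSub ▸ u ]
    ≡⟨ cong (λ x → t [ x ▸ var zero ] [ idSub ▸ u ]) (↑-wkSub o s) ⟩
  t [ wkSub o s ↑ ▸ var zero ] [ idSub ▸ u ]
    ≡⟨ sub-sub t (wkSub o s ↑ ▸ var zero) (idSub ▸ u) ⟩
  t [ (wkSub o s ↑ ∘s (idSub ▸ u)) ▸ u ]
    ≡⟨ cong (λ x → t [ x ▸ u ]) (wkSub-∘sˡ (drop idOPE) (wkSub o s) (idSub ▸ u)) ⟩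
  t [ (wkSub o s ∘s (idSub ⊙ idOPE)) ▸ u ]
    ≡⟨ cong (λ x → t [ (wkSub o s ∘s x) ▸ u ]) (⊙-identityʳ idSub) ⟩
  t [ (wkSub o s ∘s idSub) ▸ u ]
    ≡⟨ cong (λ x → t [ x ▸ u ]) (∘s-identityʳ (wkSub o s)) ⟩
  t [ wkSub o s ▸ u ]
    ∎))
  where open ≡-Reasoning

-- Normal forms

mutual
  data Ne : Ctx → Ty → Set where
    var   : ∀ {Γ A} → Γ ∋ A → Ne Γ A
    app   : ∀ {Γ A B} → Ne Γ (A ⇒ B) → Nf Γ A → Ne Γ B
    unbox : ∀ {Γ Δ A} → Ne Δ (□ A) → Δ ◁ Γ → Ne Γ A

  data Nf : Ctx → Ty → Set where
    ne  : ∀ {Γ} → Ne Γ ι → Nf Γ ι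
    lam : ∀ {Γ A B} → Nf (Γ `, A) B → Nf Γ (A ⇒ B)
    box : ∀ {Γ A} → Nf (Γ ,🔒) A → Nf Γ (□ A)

mutual
  embNe : ∀ {Γ A} → Ne Γ A → Γ ⊢ A
  embNe (var v) = var v
  embNe (app n m) = app (embNe n) (embNf m)
  embNe (unbox n e) = unbox (embNe n) e

  embNf : ∀ {Γ A} → Nf Γ A → Γ ⊢ A
  embNf (ne n) = embNe n
  embNf (lam n) = lam (embNf n)
  embNf (box n) = box (embNf n)

mutual
  wkNe : ∀ {Γ Δ A} → Γ ≤ Δ → Ne Δ A → Ne Γ A
  wkNe o (var v) = var (wkVar o v)
  wkNe o (app n m) = app (wkNe o n) (wkNf o m)
  wkNe o (unbox n e) = unbox (wkNe (ope (factorOPE o e)) n) (acc (factorOPE o e))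

  wkNf : ∀ {Γ Δ A} → Γ ≤ Δ → Nf Δ A → Nf Γ A
  wkNf o (ne n) = ne (wkNe o n)
  wkNf o (lam n) = lam (wkNf (keep o) n)
  wkNf o (box n) = box (wkNf (keep🔒 o) n)

mutual
  wkNe-id : ∀ {Γ A} (n : Ne Γ A) → wkNe idOPE n ≡ n
  wkNe-id (var v) = cong var (wkVar-id v)
  wkNe-id (app n m) = cong₂ app (wkNe-id n) (wkNf-id m)
  wkNe-id (unbox n e) rewrite factorOPE-id e = cong (λ x → unbox x e) (wkNe-id n)

  wkNf-id : ∀ {Γ A} (n : Nf Γ A) → wkNf idOPE n ≡ n
  wkNf-id (ne n) = cong ne (wkNe-id n)
  wkNf-id (lam n) = cong lam (wkNf-id n)
  wkNf-id (box n) = cong box (wkNf-id n)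

mutual
  wkNe-∙ : ∀ {Γ Δ Θ A} (o : Γ ≤ Δ) (o' : Δ ≤ Θ) (n : Ne Θ A) → wkNe (o ∙ o') n ≡ wkNe o (wkNe o' n)
  wkNe-∙ o o' (var v) = cong var (wkVar-∙ o o' v)
  wkNe-∙ o o' (app n m) = cong₂ app (wkNe-∙ o o' n) (wkNf-∙ o o' m)
  wkNe-∙ o o' (unbox n e) rewrite factorOPE-∙ o o' e =
    cong (λ x → unbox x _) (wkNe-∙ (ope (factorOPE o (acc (factorOPE o' e)))) (ope (factorOPE o' e)) n)

  wkNf-∙ : ∀ {Γ Δ Θ A} (o : Γ ≤ Δ) (o' : Δ ≤ Θ) (n : Nf Θ A) → wkNf (o ∙ o') n ≡ wkNf o (wkNf o' n)
  wkNf-∙ o o' (ne n) = cong ne (wkNe-∙ o o' n)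
  wkNf-∙ o o' (lam n) = cong lam (wkNf-∙ (keep o) (keep o') n)
  wkNf-∙ o o' (box n) = cong box (wkNf-∙ (keep🔒 o) (keep🔒 o') n)

mutual
  embNe-wk : ∀ {Γ Δ A} (o : Γ ≤ Δ) (n : Ne Δ A) → embNe (wkNe o n) ≡ wk o (embNe n)
  embNe-wk o (var v) = refl
  embNe-wk o (app n m) = cong₂ app (embNe-wk o n) (embNf-wk o m)
  embNe-wk o (unbox n e) = cong (λ x → unbox x _) (embNe-wk _ n)

  embNf-wk : ∀ {Γ Δ A} (o : Γ ≤ Δ) (n : Nf Δ A) → embNf (wkNf o n) ≡ wk o (embNf n)
  embNf-wk o (ne n) = embNe-wk o n
  embNf-wk o (lam n) = cong lam (embNf-wk (keep o) n)
  embNf-wk o (box n) = cong box (embNf-wk (keep🔒 o) n)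

_≟Ty_ : (A B : Ty) → Dec (A ≡ B)
ι ≟Ty ι = yes refl
(A ⇒ A') ≟Ty (B ⇒ B') =
  map′ (λ (p , q) → cong₂ _⇒_ p q) (λ { refl → refl , refl }) (A ≟Ty B ×-dec A' ≟Ty B')
(□ A) ≟Ty (□ B) = map′ (cong □_) (λ { refl → refl }) (A ≟Ty B)
ι ≟Ty (_ ⇒ _) = no (λ ())
ι ≟Ty (□ _) = no (λ ())
(_ ⇒ _) ≟Ty ι = no (λ ())
(_ ⇒ _) ≟Ty (□ _) = no (λ ())
(□ _) ≟Ty ι = no (λ ())
(□ _) ≟Ty (_ ⇒ _) = no (λ ())

_≟Ctx_ : (Γ Δ : Ctx) → Dec (Γ ≡ Δ)
· ≟Ctx · = yes refl
(Γ `, A) ≟Ctx (Δ `, B) =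
  map′ (λ (p , q) → cong₂ _`,_ p q) (λ { refl → refl , refl }) (Γ ≟Ctx Δ ×-dec A ≟Ty B)
(Γ ,🔒) ≟Ctx (Δ ,🔒) = map′ (cong _,🔒) (λ { refl → refl }) (Γ ≟Ctx Δ)
· ≟Ctx (_ `, _) = no (λ ())
· ≟Ctx (_ ,🔒) = no (λ ())
(_ `, _) ≟Ctx · = no (λ ())
(_ `, _) ≟Ctx (_ ,🔒) = no (λ ())
(_ ,🔒) ≟Ctx · = no (λ ())
(_ ,🔒) ≟Ctx (_ `, _) = no (λ ())

_≟Var_ : ∀ {Γ A} (v w : Γ ∋ A) → Dec (v ≡ w)
zero ≟Var zero = yes refl
succ v ≟Var succ w = map′ (cong succ) (λ { refl → refl }) (v ≟Var w)
zero ≟Var succ _ = no (λ ())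
succ _ ≟Var zero = no (λ ())

◁-irrelevant : ∀ {Γ Δ} (e e' : Δ ◁ Γ) → e ≡ e'
◁-irrelevant nil nil = refl
◁-irrelevant (ext e) (ext e') = cong ext (◁-irrelevant e e')

mutual
  _≟Ne_ : ∀ {Γ A} (n m : Ne Γ A) → Dec (n ≡ m)
  var v ≟Ne var w = map′ (cong var) (λ { refl → refl }) (v ≟Var w)
  app {A = A} n x ≟Ne app {A = A'} m y with A ≟Ty A'
  ... | no A≢A' = no (λ { refl → A≢A' refl })
  ... | yes refl = map′ (λ (p , q) → cong₂ app p q) (λ { refl → refl , refl }) (n ≟Ne m ×-dec x ≟Nf y)
  unbox {Δ = Δ} n e ≟Ne unbox {Δ = Δ'} m e' with Δ ≟Ctx Δ'
  ... | no Δ≢Δ' = no (λ { refl → Δ≢Δ' refl })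
  ... | yes refl = map′ (λ p → cong₂ unbox p (◁-irrelevant e e')) (λ { refl → refl }) (n ≟Ne m)
  var _ ≟Ne app _ _ = no (λ ())
  var _ ≟Ne unbox _ _ = no (λ ())
  app _ _ ≟Ne var _ = no (λ ())
  app _ _ ≟Ne unbox _ _ = no (λ ())
  unbox _ _ ≟Ne var _ = no (λ ())
  unbox _ _ ≟Ne app _ _ = no (λ ())

  _≟Nf_ : ∀ {Γ A} (n m : Nf Γ A) → Dec (n ≡ m)
  ne n ≟Nf ne m = map′ (cong ne) (λ { refl → refl }) (n ≟Ne m)
  lam n ≟Nf lam m = map′ (cong lam) (λ { refl → refl }) (n ≟Nf m)
  box n ≟Nf box m = map′ (cong box) (λ { refl → refl }) (n ≟Nf m)

-- Evaluation and reification

⟦_⟧ : Ty → Ctx → Set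
⟦ ι ⟧ Γ = Ne Γ ι
⟦ A ⇒ B ⟧ Γ = ∀ {Δ} → Δ ≤ Γ → ⟦ A ⟧ Δ → ⟦ B ⟧ Δ
⟦ □ A ⟧ Γ = ⟦ A ⟧ (Γ ,🔒)

-- A record rather than a data type: η makes mapLocked below definitionally functorial.
record Locked (E : Ctx → Set) (Γ : Ctx) : Set where
  constructor locked
  field
    {Θ}     : Ctx
    lockAcc : Θ ◁ Γ
    lockVal : E Θ

Env : Ctx → Ctx → Set
Env · Γ = ⊤
Env (Δ `, A) Γ = Env Δ Γ × ⟦ A ⟧ Γ
Env (Δ ,🔒) Γ = Locked (Env Δ) Γ

wkVal : ∀ A {Γ Γ'} → Γ' ≤ Γ → ⟦ A ⟧ Γ → ⟦ A ⟧ Γ'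
wkVal ι o n = wkNe o n
wkVal (A ⇒ B) o f = λ o' a → f (o' ∙ o) a
wkVal (□ A) o v = wkVal A (keep🔒 o) v

wkEnv : ∀ Δ {Γ Γ'} → Γ' ≤ Γ → Env Δ Γ → Env Δ Γ'
wkEnv · o ρ = tt
wkEnv (Δ `, A) o (ρ , a) = wkEnv Δ o ρ , wkVal A o a
wkEnv (Δ ,🔒) o (locked e ρ) = locked (acc (factorOPE o e)) (wkEnv Δ (ope (factorOPE o e)) ρ)

lookup : ∀ {Δ A Γ} → Δ ∋ A → Env Δ Γ → ⟦ A ⟧ Γ
lookup zero (ρ , a) = a
lookup (succ v) (ρ , a) = lookup v ρ

unlockEnv : ∀ {Δ Δ' Γ} → Δ' ◁ Δ → Env Δ Γ → Locked (Env Δ') Γ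
unlockEnv nil ρ = ρ
unlockEnv (ext e) (ρ , a) = unlockEnv e ρ

mutual
  eval : ∀ {Δ A Γ} → Δ ⊢ A → Env Δ Γ → ⟦ A ⟧ Γ
  eval (var v) ρ = lookup v ρ
  eval {Δ} (lam t) ρ = λ o a → eval t (wkEnv Δ o ρ , a)
  eval (app t u) ρ = eval t ρ idOPE (eval u ρ)
  eval (box t) ρ = eval t (locked nil ρ)
  eval (unbox t e) ρ = unboxVal t (unlockEnv e ρ)

  unboxVal : ∀ {Δ A Γ} → Δ ⊢ (□ A) → Locked (Env Δ) Γ → ⟦ A ⟧ Γ
  unboxVal {A = A} t (locked e ρ) = wkVal A (factor e) (eval t ρ)

mutual
  reify : ∀ A {Γ} → ⟦ A ⟧ Γ → Nf Γ A
  reify ι n = ne n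
  reify (A ⇒ B) f = lam (reify B (f (drop idOPE) (reflect A (var zero))))
  reify (□ A) v = box (reify A v)

  reflect : ∀ A {Γ} → Ne Γ A → ⟦ A ⟧ Γ
  reflect ι n = n
  reflect (A ⇒ B) n = λ o a → reflect B (app (wkNe o n) (reify A a))
  reflect (□ A) n = reflect A (unbox n nil)

idEnv : ∀ {Γ} → Env Γ Γ
idEnv {·} = tt
idEnv {Γ `, A} = wkEnv Γ (drop idOPE) idEnv , reflect A (var zero)
idEnv {Γ ,🔒} = locked nil idEnv

nf : ∀ {Γ A} → Γ ⊢ A → Nf Γ A
nf {A = A} t = reify A (eval t idEnv)

-- Soundness: equivalent terms have equal normal forms

mutual
  Eq : ∀ A {Γ} → ⟦ A ⟧ Γ → ⟦ A ⟧ Γ → Set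
  Eq ι n m = n ≡ m
  Eq (A ⇒ B) {Γ} f g = (∀ {Δ} (o : Δ ≤ Γ) {a b} → Eq A a b → Eq B (f o a) (g o b)) × Uniform A B f × Uniform A B g
  Eq (□ A) v w = Eq A v w

  Uniform : ∀ A B {Γ} → ⟦ A ⇒ B ⟧ Γ → Set
  Uniform A B {Γ} f = ∀ {Δ Δ'} (o : Δ ≤ Γ) (o' : Δ' ≤ Δ) {a} → Eq A a a →
    Eq B (wkVal B o' (f o a)) (f (o' ∙ o) (wkVal A o' a))

module _ A B {Γ} {f g : ⟦ A ⇒ B ⟧ Γ} (f≈g : Eq (A ⇒ B) f g) where

  Eq-app : ∀ {Δ} (o : Δ ≤ Γ) {a b} → Eq A a b → Eq B (f o a) (g o b)
  Eq-app = proj₁ f≈g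

  Eq-uniformˡ : Uniform A B f
  Eq-uniformˡ = proj₁ (proj₂ f≈g)

  Eq-uniformʳ : Uniform A B g
  Eq-uniformʳ = proj₂ (proj₂ f≈g)

Eq-sym : ∀ A {Γ} {a b : ⟦ A ⟧ Γ} → Eq A a b → Eq A b a
Eq-sym ι p = sym p
Eq-sym (A ⇒ B) (p , uf , ug) = (λ o q → Eq-sym B (p o (Eq-sym A q))) , ug , uf
Eq-sym (□ A) p = Eq-sym A p

Eq-trans : ∀ A {Γ} {a b c : ⟦ A ⟧ Γ} → Eq A a b → Eq A b c → Eq A a c
Eq-trans ι p q = trans p q
Eq-trans (A ⇒ B) (p , uf , _) (q , _ , uh) =
  (λ o r → Eq-trans B (p o r) (q o (Eq-trans A (Eq-sym A r) r))) , uf , uh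
Eq-trans (□ A) p q = Eq-trans A p q

Eq-reflˡ : ∀ A {Γ} {a b : ⟦ A ⟧ Γ} → Eq A a b → Eq A a a
Eq-reflˡ A p = Eq-trans A p (Eq-sym A p)

Eq-reflʳ : ∀ A {Γ} {a b : ⟦ A ⟧ Γ} → Eq A a b → Eq A b b
Eq-reflʳ A p = Eq-trans A (Eq-sym A p) p

≡-Eq-trans : ∀ A {Γ} {a b c : ⟦ A ⟧ Γ} → a ≡ b → Eq A b c → Eq A a c
≡-Eq-trans A refl p = p

Eq-≡-trans : ∀ A {Γ} {a b c : ⟦ A ⟧ Γ} → Eq A a b → b ≡ c → Eq A a c
Eq-≡-trans A p refl = p

Eq-reindexˡ : ∀ A B {Γ Δ} (f : ⟦ A ⇒ B ⟧ Γ) {o o' : Δ ≤ Γ} {a b} →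
  o ≡ o' → Eq B (f o a) b → Eq B (f o' a) b
Eq-reindexˡ A B f refl p = p

Eq-reindexʳ : ∀ A B {Γ Δ} (f : ⟦ A ⇒ B ⟧ Γ) {o o' : Δ ≤ Γ} {a b} →
  o ≡ o' → Eq B b (f o a) → Eq B b (f o' a)
Eq-reindexʳ A B f refl p = p

Eq-partialSetoid : Ty → Ctx → PartialSetoid 0ℓ 0ℓ
Eq-partialSetoid A Γ = record
  { Carrier = ⟦ A ⟧ Γ
  ; _≈_ = Eq A
  ; isPartialEquivalence = record { sym = Eq-sym A ; trans = Eq-trans A }
  }

module EqReasoning A {Γ} = Relation.Binary.Reasoning.PartialSetoid (Eq-partialSetoid A Γ)

wkVal-Eq : ∀ A {Γ Γ'} (o : Γ' ≤ Γ) {a b : ⟦ A ⟧ Γ} → Eq A a b → Eq A (wkVal A o a) (wkVal A o b)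
wkVal-Eq ι o p = cong (wkNe o) p
wkVal-Eq (A ⇒ B) o {a = f} {b = g} (p , uf , ug) =
  (λ o' q → p (o' ∙ o) q) ,
  (λ o₁ o₂ q → Eq-reindexʳ A B f (sym (∙-assoc o₂ o₁ o)) (uf (o₁ ∙ o) o₂ q)) ,
  (λ o₁ o₂ q → Eq-reindexʳ A B g (sym (∙-assoc o₂ o₁ o)) (ug (o₁ ∙ o) o₂ q))
wkVal-Eq (□ A) o p = wkVal-Eq A (keep🔒 o) p

wkVal-id : ∀ A {Γ} {a b : ⟦ A ⟧ Γ} → Eq A a b → Eq A (wkVal A idOPE a) b
wkVal-id ι {a = a} refl = wkNe-id a
wkVal-id (A ⇒ B) {a = f} p =
  (λ o q → Eq-reindexˡ A B f (sym (∙-identityʳ o)) (Eq-app A B p o q)) ,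
  Eq-uniformˡ A B (wkVal-Eq (A ⇒ B) idOPE p) ,
  Eq-uniformʳ A B p
wkVal-id (□ A) p = wkVal-id A p

wkVal-∙ : ∀ A {Γ Γ' Γ''} (o : Γ'' ≤ Γ') (o' : Γ' ≤ Γ) {a b : ⟦ A ⟧ Γ} → Eq A a b →
  Eq A (wkVal A (o ∙ o') a) (wkVal A o (wkVal A o' b))
wkVal-∙ ι o o' {a = a} refl = wkNe-∙ o o' a
wkVal-∙ (A ⇒ B) o o' {a = f} p =
  (λ o'' q → Eq-reindexˡ A B f (∙-assoc o'' o o') (Eq-app A B p ((o'' ∙ o) ∙ o') q)) ,
  Eq-uniformˡ A B (wkVal-Eq (A ⇒ B) (o ∙ o') p) ,
  Eq-uniformʳ A B (wkVal-Eq (A ⇒ B) o (wkVal-Eq (A ⇒ B) o' p))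
wkVal-∙ (□ A) o o' p = wkVal-∙ A (keep🔒 o) (keep🔒 o') p

data LockedRel {E : Ctx → Set} (R : ∀ {Θ} → E Θ → E Θ → Set) {Γ} : Locked E Γ → Locked E Γ → Set where
  lockedRel : ∀ {Θ} (e : Θ ◁ Γ) {ρ ρ'} → R ρ ρ' → LockedRel R (locked e ρ) (locked e ρ')

EqEnv : ∀ Δ {Γ} → Env Δ Γ → Env Δ Γ → Set
EqEnv · _ _ = ⊤
EqEnv (Δ `, A) (ρ , a) (ρ' , a') = EqEnv Δ ρ ρ' × Eq A a a'
EqEnv (Δ ,🔒) = LockedRel (EqEnv Δ)

EqEnv-sym : ∀ Δ {Γ} {ρ ρ' : Env Δ Γ} → EqEnv Δ ρ ρ' → EqEnv Δ ρ' ρ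
EqEnv-sym · p = tt
EqEnv-sym (Δ `, A) (p , q) = EqEnv-sym Δ p , Eq-sym A q
EqEnv-sym (Δ ,🔒) (lockedRel e p) = lockedRel e (EqEnv-sym Δ p)

EqEnv-trans : ∀ Δ {Γ} {ρ ρ' ρ'' : Env Δ Γ} → EqEnv Δ ρ ρ' → EqEnv Δ ρ' ρ'' → EqEnv Δ ρ ρ''
EqEnv-trans · p q = tt
EqEnv-trans (Δ `, A) (p , q) (p' , q') = EqEnv-trans Δ p p' , Eq-trans A q q'
EqEnv-trans (Δ ,🔒) (lockedRel e p) (lockedRel .e q) = lockedRel e (EqEnv-trans Δ p q)

EqEnv-reflˡ : ∀ Δ {Γ} {ρ ρ' : Env Δ Γ} → EqEnv Δ ρ ρ' → EqEnv Δ ρ ρ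
EqEnv-reflˡ Δ p = EqEnv-trans Δ p (EqEnv-sym Δ p)

EqEnv-reflʳ : ∀ Δ {Γ} {ρ ρ' : Env Δ Γ} → EqEnv Δ ρ ρ' → EqEnv Δ ρ' ρ'
EqEnv-reflʳ Δ p = EqEnv-trans Δ (EqEnv-sym Δ p) p

EqEnv-≡-trans : ∀ Δ {Γ} {ρ ρ' ρ'' : Env Δ Γ} → EqEnv Δ ρ ρ' → ρ' ≡ ρ'' → EqEnv Δ ρ ρ''
EqEnv-≡-trans Δ p refl = p

wkEnv-Eq : ∀ Δ {Γ Γ'} (o : Γ' ≤ Γ) {ρ ρ' : Env Δ Γ} → EqEnv Δ ρ ρ' → EqEnv Δ (wkEnv Δ o ρ) (wkEnv Δ o ρ')
wkEnv-Eq · o p = tt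
wkEnv-Eq (Δ `, A) o (p , q) = wkEnv-Eq Δ o p , wkVal-Eq A o q
wkEnv-Eq (Δ ,🔒) o (lockedRel e p) = lockedRel _ (wkEnv-Eq Δ _ p)

wkEnv-id : ∀ Δ {Γ} {ρ ρ' : Env Δ Γ} → EqEnv Δ ρ ρ' → EqEnv Δ (wkEnv Δ idOPE ρ) ρ'
wkEnv-id · p = tt
wkEnv-id (Δ `, A) (p , q) = wkEnv-id Δ p , wkVal-id A q
wkEnv-id (Δ ,🔒) (lockedRel e p) rewrite factorOPE-id e = lockedRel e (wkEnv-id Δ p)

wkEnv-∙ : ∀ Δ {Γ Γ' Γ''} (o : Γ'' ≤ Γ') (o' : Γ' ≤ Γ) {ρ ρ' : Env Δ Γ} → EqEnv Δ ρ ρ' →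
  EqEnv Δ (wkEnv Δ (o ∙ o') ρ) (wkEnv Δ o (wkEnv Δ o' ρ'))
wkEnv-∙ · o o' p = tt
wkEnv-∙ (Δ `, A) o o' (p , q) = wkEnv-∙ Δ o o' p , wkVal-∙ A o o' q
wkEnv-∙ (Δ ,🔒) o o' (lockedRel e p) rewrite factorOPE-∙ o o' e = lockedRel _ (wkEnv-∙ Δ _ _ p)

lookup-Eq : ∀ {Δ A Γ} (v : Δ ∋ A) {ρ ρ' : Env Δ Γ} → EqEnv Δ ρ ρ' → Eq A (lookup v ρ) (lookup v ρ')
lookup-Eq zero (p , q) = q
lookup-Eq (succ v) (p , q) = lookup-Eq v p

lookup-natural : ∀ {Δ A Γ Γ'} (v : Δ ∋ A) (o : Γ' ≤ Γ) {ρ : Env Δ Γ} → EqEnv Δ ρ ρ →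
  Eq A (wkVal A o (lookup v ρ)) (lookup v (wkEnv Δ o ρ))
lookup-natural {A = A} zero o (p , q) = wkVal-Eq A o q
lookup-natural (succ v) o (p , q) = lookup-natural v o p

unlockEnv-Eq : ∀ {Δ Δ' Γ} (e : Δ' ◁ Δ) {ρ ρ' : Env Δ Γ} → EqEnv Δ ρ ρ' →
  LockedRel (EqEnv Δ') (unlockEnv e ρ) (unlockEnv e ρ')
unlockEnv-Eq nil p = p
unlockEnv-Eq (ext e) (p , q) = unlockEnv-Eq e p

unlockEnv-wkEnv : ∀ {Δ Δ' Γ Γ'} (e : Δ' ◁ Δ) (o : Γ' ≤ Γ) (ρ : Env Δ Γ) →
  unlockEnv e (wkEnv Δ o ρ) ≡ wkEnv (Δ' ,🔒) o (unlockEnv e ρ)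
unlockEnv-wkEnv nil o ρ = refl
unlockEnv-wkEnv (ext e) o (ρ , a) = unlockEnv-wkEnv e o ρ

mapLocked : ∀ {E F : Ctx → Set} {Γ} → (∀ {Θ} → E Θ → F Θ) → Locked E Γ → Locked F Γ
mapLocked g (locked e ρ) = locked e (g ρ)

mapLocked-Rel : ∀ {E F : Ctx → Set} {R : ∀ {Θ} → E Θ → E Θ → Set} {S : ∀ {Θ} → F Θ → F Θ → Set} {Γ}
  {g h : ∀ {Θ} → E Θ → F Θ} → (∀ {Θ} {ρ ρ' : E Θ} → R ρ ρ' → S (g ρ) (h ρ')) →
  {f f' : Locked E Γ} → LockedRel R f f' → LockedRel S (mapLocked g f) (mapLocked h f')
mapLocked-Rel gh (lockedRel e q) = lockedRel e (gh q)

unboxVal-map : ∀ {Δ Δ' A Γ} (t : Δ ⊢ (□ A)) (t' : Δ' ⊢ (□ A)) (g : ∀ {Θ} → Env Δ Θ → Env Δ' Θ) →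
  (∀ {Θ} {ρ ρ' : Env Δ Θ} → EqEnv Δ ρ ρ' → Eq (□ A) (eval t ρ) (eval t' (g ρ'))) →
  {f f' : Locked (Env Δ) Γ} → LockedRel (EqEnv Δ) f f' → Eq A (unboxVal t f) (unboxVal t' (mapLocked g f'))
unboxVal-map {A = A} t t' g tt' (lockedRel e q) = wkVal-Eq A (factor e) (tt' q)

mutual
  eval-Eq : ∀ {Δ A Γ} (t : Δ ⊢ A) {ρ ρ' : Env Δ Γ} → EqEnv Δ ρ ρ' → Eq A (eval t ρ) (eval t ρ')
  eval-Eq (var v) p = lookup-Eq v p
  eval-Eq {Δ} (lam t) p =
    (λ o q → eval-Eq t (wkEnv-Eq Δ o p , q)) , lam-uniform t (EqEnv-reflˡ Δ p) , lam-uniform t (EqEnv-reflʳ Δ p)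
  eval-Eq {A = B} (app {A = A} t u) p = Eq-app A B (eval-Eq t p) idOPE (eval-Eq u p)
  eval-Eq (box t) p = eval-Eq t (lockedRel nil p)
  eval-Eq (unbox t e) p = unboxVal-map t t (λ ρ → ρ) (eval-Eq t) (unlockEnv-Eq e p)

  lam-uniform : ∀ {Δ A B Γ} (t : (Δ `, A) ⊢ B) {ρ : Env Δ Γ} → EqEnv Δ ρ ρ → Uniform A B (eval (lam t) ρ)
  lam-uniform {Δ} {A} {B} t p o o' q =
    Eq-trans B (eval-natural t o' (wkEnv-Eq Δ o p , q)) (eval-Eq t (EqEnv-sym Δ (wkEnv-∙ Δ o' o p) , wkVal-Eq A o' q))

  eval-natural : ∀ {Δ A Γ Γ'} (t : Δ ⊢ A) (o : Γ' ≤ Γ) {ρ : Env Δ Γ} → EqEnv Δ ρ ρ →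
    Eq A (wkVal A o (eval t ρ)) (eval t (wkEnv Δ o ρ))
  eval-natural (var v) o p = lookup-natural v o p
  eval-natural {Δ} {A ⇒ B} (lam t) o p =
    (λ o' q → eval-Eq t (wkEnv-∙ Δ o' o p , q)) ,
    Eq-uniformˡ A B (wkVal-Eq (A ⇒ B) o (eval-Eq (lam t) p)) ,
    lam-uniform t (wkEnv-Eq Δ o p)
  eval-natural {Δ} {B} (app {A = A} t u) o {ρ} p = begin
    wkVal B o (eval t ρ idOPE (eval u ρ))
      ≈⟨ Eq-uniformˡ A B (eval-Eq t p) idOPE o (eval-Eq u p) ⟩
    eval t ρ (o ∙ idOPE) (wkVal A o (eval u ρ))
      ≡⟨ cong (λ o' → eval t ρ o' (wkVal A o (eval u ρ))) (∙-identity-swap o) ⟩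
    eval t ρ (idOPE ∙ o) (wkVal A o (eval u ρ))
      ≈⟨ Eq-app A B (eval-natural t o p) idOPE (eval-natural u o p) ⟩
    eval t (wkEnv Δ o ρ) idOPE (eval u (wkEnv Δ o ρ))
      ∎
    where open EqReasoning B
  eval-natural (box t) o p = eval-natural t (keep🔒 o) (lockedRel nil p)
  eval-natural (unbox t e) o {ρ} p rewrite unlockEnv-wkEnv e o ρ = unboxVal-natural t o (unlockEnv-Eq e p)

  unboxVal-natural : ∀ {Δ A Γ Γ'} (t : Δ ⊢ (□ A)) (o : Γ' ≤ Γ) {f : Locked (Env Δ) Γ} →
    LockedRel (EqEnv Δ) f f →
    Eq A (wkVal A o (unboxVal t f)) (unboxVal t (wkEnv (Δ ,🔒) o f))
  unboxVal-natural {A = A} t o (lockedRel e {ρ} q) = begin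
    wkVal A o (wkVal A (factor e) (eval t ρ))
      ≈⟨ wkVal-∙ A o (factor e) (eval-Eq t q) ⟨
    wkVal A (o ∙ factor e) (eval t ρ)
      ≡⟨ cong (λ o' → wkVal A o' (eval t ρ)) (factor-natural o e) ⟩
    wkVal A (factor (acc (factorOPE o e)) ∙ keep🔒 (ope (factorOPE o e))) (eval t ρ)
      ≈⟨ wkVal-∙ A (factor (acc (factorOPE o e))) (keep🔒 (ope (factorOPE o e))) (eval-Eq t q) ⟩
    wkVal A (factor (acc (factorOPE o e))) (wkVal A (keep🔒 (ope (factorOPE o e))) (eval t ρ))
      ≈⟨ wkVal-Eq A (factor (acc (factorOPE o e))) (eval-natural t (ope (factorOPE o e)) q) ⟩
    wkVal A (factor (acc (factorOPE o e))) (eval t (wkEnv _ (ope (factorOPE o e)) ρ))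
      ∎
    where open EqReasoning A

projEnv : ∀ {Γ Δ Θ} → Γ ≤ Δ → Env Γ Θ → Env Δ Θ
projEnv base ρ = tt
projEnv (drop o) (ρ , a) = projEnv o ρ
projEnv (keep o) (ρ , a) = projEnv o ρ , a
projEnv (keep🔒 o) (locked e ρ) = locked e (projEnv o ρ)

projEnv-id : ∀ {Γ Θ} (ρ : Env Γ Θ) → projEnv idOPE ρ ≡ ρ
projEnv-id {·} ρ = refl
projEnv-id {Γ `, A} (ρ , a) = cong (_, a) (projEnv-id ρ)
projEnv-id {Γ ,🔒} (locked e ρ) = cong (locked e) (projEnv-id ρ)

projEnv-Eq : ∀ {Γ Δ Θ} (o : Γ ≤ Δ) {ρ ρ' : Env Γ Θ} → EqEnv Γ ρ ρ' → EqEnv Δ (projEnv o ρ) (projEnv o ρ')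
projEnv-Eq base p = tt
projEnv-Eq (drop o) (p , q) = projEnv-Eq o p
projEnv-Eq (keep o) (p , q) = projEnv-Eq o p , q
projEnv-Eq (keep🔒 o) (lockedRel e p) = lockedRel e (projEnv-Eq o p)

projEnv-wkEnv : ∀ {Γ Δ Θ Θ'} (o : Γ ≤ Δ) (o' : Θ' ≤ Θ) (ρ : Env Γ Θ) →
  projEnv o (wkEnv Γ o' ρ) ≡ wkEnv Δ o' (projEnv o ρ)
projEnv-wkEnv base o' ρ = refl
projEnv-wkEnv (drop o) o' (ρ , a) = projEnv-wkEnv o o' ρ
projEnv-wkEnv (keep o) o' (ρ , a) = cong (_, _) (projEnv-wkEnv o o' ρ)
projEnv-wkEnv (keep🔒 o) o' (locked e ρ) = cong (locked _) (projEnv-wkEnv o _ ρ)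

lookup-projEnv : ∀ {Γ Δ Θ A} (o : Γ ≤ Δ) (v : Δ ∋ A) (ρ : Env Γ Θ) →
  lookup (wkVar o v) ρ ≡ lookup v (projEnv o ρ)
lookup-projEnv (drop o) v (ρ , a) = lookup-projEnv o v ρ
lookup-projEnv (keep o) zero (ρ , a) = refl
lookup-projEnv (keep o) (succ v) (ρ , a) = lookup-projEnv o v ρ

unlockEnv-projEnv : ∀ {Γ Δ Ξ Θ} (o : Γ ≤ Δ) (e : Ξ ◁ Δ) (ρ : Env Γ Θ) →
  unlockEnv e (projEnv o ρ) ≡ mapLocked (projEnv (ope (factorOPE o e))) (unlockEnv (acc (factorOPE o e)) ρ)
unlockEnv-projEnv (drop o) e (ρ , a) = unlockEnv-projEnv o e ρ
unlockEnv-projEnv (keep o) (ext e) (ρ , a) = unlockEnv-projEnv o e ρ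
unlockEnv-projEnv (keep🔒 o) nil (locked e ρ) = refl

projEnv-factor : ∀ {Γ Δ Θ} (e : Δ ◁ Γ) (ρ : Env Γ Θ) → projEnv (factor e) ρ ≡ unlockEnv e ρ
projEnv-factor nil (locked e ρ) = cong (locked e) (projEnv-id ρ)
projEnv-factor (ext e) (ρ , a) = projEnv-factor e ρ

eval-wk : ∀ {Γ Δ A Θ} (o : Γ ≤ Δ) (t : Δ ⊢ A) {ρ ρ' : Env Γ Θ} → EqEnv Γ ρ ρ' →
  Eq A (eval (wk o t) ρ) (eval t (projEnv o ρ'))
eval-wk {A = A} o (var v) {ρ} p = ≡-Eq-trans A (lookup-projEnv o v ρ) (lookup-Eq v (projEnv-Eq o p))
eval-wk {Γ} {A = A ⇒ B} o (lam t) {ρ' = ρ'} p =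
  (λ o' q → Eq-≡-trans B (eval-wk (keep o) t (wkEnv-Eq Γ o' p , q))
                         (cong (λ σ → eval t (σ , _)) (projEnv-wkEnv o o' ρ'))) ,
  lam-uniform (wk (keep o) t) (EqEnv-reflˡ Γ p) ,
  lam-uniform t (projEnv-Eq o (EqEnv-reflʳ Γ p))
eval-wk {A = B} o (app {A = A} t u) p = Eq-app A B (eval-wk o t p) idOPE (eval-wk o u p)
eval-wk o (box t) p = eval-wk (keep🔒 o) t (lockedRel nil p)
eval-wk o (unbox t e) {ρ' = ρ'} p rewrite unlockEnv-projEnv o e ρ' =
  unboxVal-map (wk (ope (factorOPE o e)) t) t (projEnv (ope (factorOPE o e))) (eval-wk (ope (factorOPE o e)) t)
    (unlockEnv-Eq (acc (factorOPE o e)) p)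

eval-wk-drop : ∀ {Γ A B Θ} (t : Γ ⊢ A) {ρ ρ' : Env Γ Θ} {b b' : ⟦ B ⟧ Θ} → EqEnv Γ ρ ρ' → Eq B b b' →
  Eq A (eval (wk (drop idOPE) t) (ρ , b)) (eval t ρ')
eval-wk-drop {Γ} {A} {B} t {ρ' = ρ'} p q =
  Eq-≡-trans A (eval-wk (drop {A = B} idOPE) t (p , q)) (cong (eval t) (projEnv-id ρ'))

evalSub : ∀ {Γ Δ Θ} → Γ ⊢s Δ → Env Γ Θ → Env Δ Θ
evalSub empty ρ = tt
evalSub (s ▸ t) ρ = evalSub s ρ , eval t ρ
evalSub (lock s e) ρ = mapLocked (evalSub s) (unlockEnv e ρ)

evalSub-Eq : ∀ {Γ Δ Θ} (s : Γ ⊢s Δ) {ρ ρ' : Env Γ Θ} → EqEnv Γ ρ ρ' → EqEnv Δ (evalSub s ρ) (evalSub s ρ')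
evalSub-Eq empty p = tt
evalSub-Eq (s ▸ t) p = evalSub-Eq s p , eval-Eq t p
evalSub-Eq (lock s e) p = mapLocked-Rel (evalSub-Eq s) (unlockEnv-Eq e p)

evalSub-wk : ∀ {Γ Γ' Δ Θ} (o : Γ' ≤ Γ) (s : Γ ⊢s Δ) {ρ ρ' : Env Γ' Θ} → EqEnv Γ' ρ ρ' →
  EqEnv Δ (evalSub (wkSub o s) ρ) (evalSub s (projEnv o ρ'))
evalSub-wk o empty p = tt
evalSub-wk o (s ▸ t) p = evalSub-wk o s p , eval-wk o t p
evalSub-wk o (lock s e) {ρ' = ρ'} p rewrite unlockEnv-projEnv o e ρ' =
  mapLocked-Rel (evalSub-wk (ope (factorOPE o e)) s) (unlockEnv-Eq (acc (factorOPE o e)) p)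

evalSub-↑ : ∀ {Γ Δ A Θ} (s : Γ ⊢s Δ) {ρ ρ' : Env Γ Θ} {a a' : ⟦ A ⟧ Θ} → EqEnv Γ ρ ρ' → Eq A a a' →
  EqEnv Δ (evalSub (s ↑) (ρ , a)) (evalSub s ρ')
evalSub-↑ {Δ = Δ} {A} s {ρ' = ρ'} p q =
  EqEnv-≡-trans Δ (evalSub-wk (drop {A = A} idOPE) s (p , q)) (cong (evalSub s) (projEnv-id ρ'))

evalSub-natural : ∀ {Γ Δ Θ Θ'} (o : Θ' ≤ Θ) (s : Γ ⊢s Δ) {ρ : Env Γ Θ} → EqEnv Γ ρ ρ →
  EqEnv Δ (wkEnv Δ o (evalSub s ρ)) (evalSub s (wkEnv Γ o ρ))
evalSub-natural o empty p = tt
evalSub-natural o (s ▸ t) p = evalSub-natural o s p , eval-natural t o p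
evalSub-natural {Δ = Δ ,🔒} o (lock {Ξ} s e) {ρ} p rewrite unlockEnv-wkEnv e o ρ = locked-natural (unlockEnv-Eq e p)
  where
  locked-natural : {f : Locked (Env Ξ) _} → LockedRel (EqEnv Ξ) f f →
    EqEnv (Δ ,🔒) (wkEnv (Δ ,🔒) o (mapLocked (evalSub s) f)) (mapLocked (evalSub s) (wkEnv (Ξ ,🔒) o f))
  locked-natural (lockedRel e' q) = lockedRel _ (evalSub-natural _ s q)

evalSub-id : ∀ {Γ Θ} {ρ ρ' : Env Γ Θ} → EqEnv Γ ρ ρ' → EqEnv Γ (evalSub idSub ρ) ρ'
evalSub-id {·} p = tt
evalSub-id {Γ `, A} (p , q) = EqEnv-trans Γ (evalSub-↑ {A = A} idSub (EqEnv-reflˡ Γ p) (Eq-reflˡ A q)) (evalSub-id p) , q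
evalSub-id {Γ ,🔒} (lockedRel e p) = lockedRel e (evalSub-id p)

substVar-eval : ∀ {Γ Δ A Θ} (v : Δ ∋ A) (s : Γ ⊢s Δ) {ρ ρ' : Env Γ Θ} → EqEnv Γ ρ ρ' →
  Eq A (eval (substVar v s) ρ) (lookup v (evalSub s ρ'))
substVar-eval zero (s ▸ t) p = eval-Eq t p
substVar-eval (succ v) (s ▸ t) p = substVar-eval v s p

unlockEnv-evalSub : ∀ {Γ Δ Ξ Θ} (e : Ξ ◁ Δ) (s : Γ ⊢s Δ) (ρ : Env Γ Θ) →
  unlockEnv e (evalSub s ρ) ≡ mapLocked (evalSub (sub (factorSub s e))) (unlockEnv (acc (factorSub s e)) ρ)
unlockEnv-evalSub nil (lock s e) ρ = refl
unlockEnv-evalSub (ext e) (s ▸ t) ρ = unlockEnv-evalSub e s ρ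

eval-sub : ∀ {Γ Δ A Θ} (t : Δ ⊢ A) (s : Γ ⊢s Δ) {ρ ρ' : Env Γ Θ} → EqEnv Γ ρ ρ' →
  Eq A (eval (t [ s ]) ρ) (eval t (evalSub s ρ'))
eval-sub (var v) s p = substVar-eval v s p
eval-sub {Γ} {Δ} {A ⇒ B} {Θ} (lam t) s {ρ' = ρ'} p =
  (λ o q → Eq-trans B (eval-sub t (s ↑ ▸ var zero) (wkEnv-Eq Γ o p , q))
                      (eval-Eq t (weakened-evalSub o (Eq-reflʳ A q) , Eq-reflʳ A q))) ,
  lam-uniform (t [ s ↑ ▸ var zero ]) (EqEnv-reflˡ Γ p) ,
  lam-uniform t (evalSub-Eq s (EqEnv-reflʳ Γ p))
  where
  p' : EqEnv Γ ρ' ρ'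
  p' = EqEnv-reflʳ Γ p

  weakened-evalSub : ∀ {Θ'} (o : Θ' ≤ Θ) {b} → Eq A b b →
    EqEnv Δ (evalSub (s ↑) (wkEnv Γ o ρ' , b)) (wkEnv Δ o (evalSub s ρ'))
  weakened-evalSub o q = EqEnv-trans Δ (evalSub-↑ {A = A} s (wkEnv-Eq Γ o p') q) (EqEnv-sym Δ (evalSub-natural o s p'))
eval-sub {A = B} (app {A = A} t u) s p = Eq-app A B (eval-sub t s p) idOPE (eval-sub u s p)
eval-sub (box t) s p = eval-sub t (lock s nil) (lockedRel nil p)
eval-sub (unbox t e) s {ρ' = ρ'} p rewrite unlockEnv-evalSub e s ρ' =
  unboxVal-map (t [ sub (factorSub s e) ]) t (evalSub (sub (factorSub s e))) (eval-sub t (sub (factorSub s e)))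
    (unlockEnv-Eq (acc (factorSub s e)) p)

⇒-β-sound : ∀ {Γ A B Θ} (t : (Γ `, A) ⊢ B) (u : Γ ⊢ A) {ρ ρ' : Env Γ Θ} → EqEnv Γ ρ ρ' →
  Eq B (eval (app (lam t) u) ρ) (eval (t [ idSub ▸ u ]) ρ')
⇒-β-sound {Γ} {B = B} t u p = Eq-trans B
  (eval-Eq t (EqEnv-trans Γ (wkEnv-id Γ p) (EqEnv-sym Γ (evalSub-id (EqEnv-reflʳ Γ p))) , eval-Eq u p))
  (Eq-sym B (eval-sub t (idSub ▸ u) (EqEnv-reflʳ Γ p)))

⇒-η-sound : ∀ {Γ A B Θ} (t : Γ ⊢ (A ⇒ B)) {ρ ρ' : Env Γ Θ} → EqEnv Γ ρ ρ' →
  Eq (A ⇒ B) (eval t ρ) (eval (lam (app (wk (drop idOPE) t) (var zero))) ρ')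
⇒-η-sound {Γ} {A} {B} {Θ} t {ρ} {ρ'} p =
  extensional , Eq-uniformˡ A B (eval-Eq t p) , lam-uniform (app (wk (drop idOPE) t) (var zero)) p'
  where
  p' : EqEnv Γ ρ' ρ'
  p' = EqEnv-reflʳ Γ p

  extensional : ∀ {Δ} (o : Δ ≤ Θ) {a b} → Eq A a b →
    Eq B (eval t ρ o a) (eval (wk (drop idOPE) t) (wkEnv Γ o ρ' , b) idOPE b)
  extensional o {a} {b} q = begin
    eval t ρ o a
      ≈⟨ Eq-app A B (eval-Eq t p) o q ⟩
    eval t ρ' o b
      ≡⟨ cong (λ o' → eval t ρ' o' b) (∙-identityˡ o) ⟨
    wkVal (A ⇒ B) o (eval t ρ') idOPE b
      ≈⟨ Eq-app A B (eval-natural t o p') idOPE (Eq-reflʳ A q) ⟩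
    eval t (wkEnv Γ o ρ') idOPE b
      ≈⟨ Eq-app A B (eval-wk-drop t (wkEnv-Eq Γ o p') (Eq-reflʳ A q)) idOPE (Eq-reflʳ A q) ⟨
    eval (wk (drop idOPE) t) (wkEnv Γ o ρ' , b) idOPE b
      ∎
    where open EqReasoning B

wkEnv-factor : ∀ {Γ Δ Θ} (e : Θ ◁ Γ) {ρ ρ' : Env Δ Θ} → EqEnv Δ ρ ρ' →
  EqEnv (Δ ,🔒) (wkEnv (Δ ,🔒) (factor e) (locked nil ρ)) (locked e ρ')
wkEnv-factor {Δ = Δ} e p rewrite factorOPE-factor e = lockedRel e (wkEnv-id Δ p)

unboxVal-box : ∀ {Δ A Γ} (t : (Δ ,🔒) ⊢ A) {f f' : Locked (Env Δ) Γ} → LockedRel (EqEnv Δ) f f' →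
  Eq A (unboxVal (box t) f) (eval t f')
unboxVal-box {Δ} {A} t (lockedRel e q) =
  Eq-trans A (eval-natural t (factor e) (lockedRel nil (EqEnv-reflˡ Δ q))) (eval-Eq t (wkEnv-factor e q))

□-β-sound : ∀ {Γ Δ A Θ} (t : (Δ ,🔒) ⊢ A) (e : Δ ◁ Γ) {ρ ρ' : Env Γ Θ} → EqEnv Γ ρ ρ' →
  Eq A (eval (unbox (box t) e) ρ) (eval (wk (factor e) t) ρ')
□-β-sound {Γ} {A = A} t e {ρ' = ρ'} p = Eq-trans A (unboxVal-box t (unlockEnv-Eq e p))
  (Eq-sym A (Eq-≡-trans A (eval-wk (factor e) t (EqEnv-reflʳ Γ p)) (cong (eval t) (projEnv-factor e ρ'))))

□-η-sound : ∀ {Γ A Θ} (t : Γ ⊢ (□ A)) {ρ ρ' : Env Γ Θ} → EqEnv Γ ρ ρ' →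
  Eq (□ A) (eval t ρ) (eval (box (unbox t nil)) ρ')
□-η-sound {A = A} t p = Eq-sym (□ A) (wkVal-id (□ A) (Eq-sym (□ A) (eval-Eq t p)))

≈-sound : ∀ {Γ A} {t u : Γ ⊢ A} → t ≈ u → ∀ {Θ} {ρ ρ' : Env Γ Θ} → EqEnv Γ ρ ρ' →
  Eq A (eval t ρ) (eval u ρ')
≈-sound (⇒-β t u) = ⇒-β-sound t u
≈-sound (⇒-η t) = ⇒-η-sound t
≈-sound (□-β t e) = □-β-sound t e
≈-sound (□-η t) = □-η-sound t
≈-sound (≈-refl {t = t}) = eval-Eq t
≈-sound {Γ} {A} (≈-sym q) p = Eq-sym A (≈-sound q (EqEnv-sym Γ p))
≈-sound {Γ} {A} (≈-trans q r) p = Eq-trans A (≈-sound q (EqEnv-reflˡ Γ p)) (≈-sound r p)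
≈-sound {Γ} (cong-lam {t = t} {t'} q) p =
  (λ o a → ≈-sound q (wkEnv-Eq Γ o p , a)) , lam-uniform t (EqEnv-reflˡ Γ p) , lam-uniform t' (EqEnv-reflʳ Γ p)
≈-sound {A = B} (cong-app {A = A} q r) p = Eq-app A B (≈-sound q p) idOPE (≈-sound r p)
≈-sound (cong-box q) p = ≈-sound q (lockedRel nil p)
≈-sound (cong-unbox {t = t} {t'} {e} q) p = unboxVal-map t t' (λ ρ → ρ) (≈-sound q) (unlockEnv-Eq e p)

mutual
  reify-Eq : ∀ A {Γ} {a b : ⟦ A ⟧ Γ} → Eq A a b → reify A a ≡ reify A b
  reify-Eq ι p = cong ne p
  reify-Eq (A ⇒ B) p = cong lam (reify-Eq B (Eq-app A B p (drop idOPE) (reflect-Eq A (var zero))))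
  reify-Eq (□ A) p = cong box (reify-Eq A p)

  reflect-Eq : ∀ A {Γ} (n : Ne Γ A) → Eq A (reflect A n) (reflect A n)
  reflect-Eq ι n = refl
  reflect-Eq (A ⇒ B) {Γ} n = extensional , uniform , uniform
    where
    extensional : ∀ {Δ} (o : Δ ≤ Γ) {a b} → Eq A a b →
      Eq B (reflect B (app (wkNe o n) (reify A a))) (reflect B (app (wkNe o n) (reify A b)))
    extensional o q = ≡-Eq-trans B (cong (λ m → reflect B (app (wkNe o n) m)) (reify-Eq A q)) (reflect-Eq B _)

    uniform : Uniform A B (reflect (A ⇒ B) n)
    uniform o o' {a} q = Eq-≡-trans B (reflect-natural B o' (app (wkNe o n) (reify A a)))
      (cong (reflect B) (cong₂ app (sym (wkNe-∙ o' o n)) (sym (reify-natural A o' q))))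
  reflect-Eq (□ A) n = reflect-Eq A (unbox n nil)

  reify-natural : ∀ A {Γ Γ'} (o : Γ' ≤ Γ) {a : ⟦ A ⟧ Γ} → Eq A a a → reify A (wkVal A o a) ≡ wkNf o (reify A a)
  reify-natural ι o p = refl
  reify-natural (A ⇒ B) o {f} p = cong lam (trans (sym (reify-Eq B body-natural))
    (reify-natural B (keep o) (Eq-app A B p (drop idOPE) (reflect-Eq A (var zero)))))
    where
    x : ∀ {Δ} → ⟦ A ⟧ (Δ `, A)
    x = reflect A (var zero)
    body-natural : Eq B (wkVal B (keep o) (f (drop idOPE) x)) (f (drop idOPE ∙ o) x)
    body-natural = begin
      wkVal B (keep o) (f (drop idOPE) x)
        ≈⟨ Eq-uniformˡ A B p (drop idOPE) (keep o) (reflect-Eq A (var zero)) ⟩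
      f (keep o ∙ drop idOPE) (wkVal A (keep o) x)
        ≈⟨ Eq-app A B p (keep o ∙ drop idOPE) (reflect-natural A (keep o) (var zero)) ⟩
      f (keep o ∙ drop idOPE) x
        ≡⟨ cong (λ o' → f o' x) (keep∙drop o) ⟩
      f (drop idOPE ∙ o) x
        ∎
      where open EqReasoning B
  reify-natural (□ A) o p = cong box (reify-natural A (keep🔒 o) p)

  reflect-natural : ∀ A {Γ Γ'} (o : Γ' ≤ Γ) (n : Ne Γ A) → Eq A (wkVal A o (reflect A n)) (reflect A (wkNe o n))
  reflect-natural ι o n = refl
  reflect-natural (A ⇒ B) o n =
    (λ o' q → ≡-Eq-trans B (cong (reflect B) (cong₂ app (wkNe-∙ o' o n) (reify-Eq A q))) (reflect-Eq B _)) ,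
    Eq-uniformˡ A B (wkVal-Eq (A ⇒ B) o (reflect-Eq (A ⇒ B) n)) ,
    Eq-uniformˡ A B (reflect-Eq (A ⇒ B) (wkNe o n))
  reflect-natural (□ A) o n = reflect-natural A (keep🔒 o) (unbox n nil)

idEnv-Eq : ∀ {Γ} → EqEnv Γ idEnv idEnv
idEnv-Eq {·} = tt
idEnv-Eq {Γ `, A} = wkEnv-Eq Γ (drop idOPE) idEnv-Eq , reflect-Eq A (var zero)
idEnv-Eq {Γ ,🔒} = lockedRel nil idEnv-Eq

nf-cong : ∀ {Γ A} {t u : Γ ⊢ A} → t ≈ u → nf t ≡ nf u
nf-cong {A = A} p = reify-Eq A (≈-sound p idEnv-Eq)

-- Completeness: every term is equivalent to its normal form

Glued : ∀ A {Γ} → Γ ⊢ A → ⟦ A ⟧ Γ → Set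
Glued ι t n = t ≈ embNe n
Glued (A ⇒ B) {Γ} t f = ∀ {Δ} (o : Δ ≤ Γ) {u a} → Glued A u a → Glued B (app (wk o t) u) (f o a)
Glued (□ A) t v = Glued A (unbox t nil) v

Glued-≈ : ∀ A {Γ} {t t' : Γ ⊢ A} {a} → t ≈ t' → Glued A t a → Glued A t' a
Glued-≈ ι p r = ≈-trans (≈-sym p) r
Glued-≈ (A ⇒ B) p r = λ o q → Glued-≈ B (cong-app (≈-wk o p) ≈-refl) (r o q)
Glued-≈ (□ A) p r = Glued-≈ A (cong-unbox p) r

Glued-wk : ∀ A {Γ Γ'} (o : Γ' ≤ Γ) {t a} → Glued A t a → Glued A (wk o t) (wkVal A o a)
Glued-wk ι o {a = n} r = ≈-trans (≈-wk o r) (≡⇒≈ (sym (embNe-wk o n)))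
Glued-wk (A ⇒ B) o {t} r = λ o' q → Glued-≈ B (cong-app (≡⇒≈ (wk-∙ o' o t)) ≈-refl) (r (o' ∙ o) q)
Glued-wk (□ A) o r = Glued-wk A (keep🔒 o) r

mutual
  Glued-reify : ∀ A {Γ} {t : Γ ⊢ A} {a} → Glued A t a → t ≈ embNf (reify A a)
  Glued-reify ι r = r
  Glued-reify (A ⇒ B) {t = t} r =
    ≈-trans (⇒-η t) (cong-lam (Glued-reify B (r (drop idOPE) (Glued-reflect A (var zero)))))
  Glued-reify (□ A) {t = t} r = ≈-trans (□-η t) (cong-box (Glued-reify A r))

  Glued-reflect : ∀ A {Γ} (n : Ne Γ A) → Glued A (embNe n) (reflect A n)
  Glued-reflect ι n = ≈-refl
  Glued-reflect (A ⇒ B) n = λ o {u} {a} q →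
    Glued-≈ B (cong-app (≡⇒≈ (embNe-wk o n)) (≈-sym (Glued-reify A q))) (Glued-reflect B (app (wkNe o n) (reify A a)))
  Glued-reflect (□ A) n = Glued-reflect A (unbox n nil)

data GluedLock {Δ} (R : ∀ {Θ} → Θ ⊢s Δ → Env Δ Θ → Set) {Γ} :
  Γ ⊢s (Δ ,🔒) → Locked (Env Δ) Γ → Set where
  glued : ∀ {Θ} (e : Θ ◁ Γ) {s ρ} → R s ρ → GluedLock R (lock s e) (locked e ρ)

GluedEnv : ∀ Δ {Γ} → Γ ⊢s Δ → Env Δ Γ → Set
GluedEnv · s ρ = ⊤
GluedEnv (Δ `, A) (s ▸ t) (ρ , a) = GluedEnv Δ s ρ × Glued A t a
GluedEnv (Δ ,🔒) s ρ = GluedLock (GluedEnv Δ) s ρ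

GluedEnv-wk : ∀ Δ {Γ Γ'} (o : Γ' ≤ Γ) {s ρ} → GluedEnv Δ s ρ → GluedEnv Δ (wkSub o s) (wkEnv Δ o ρ)
GluedEnv-wk · o r = tt
GluedEnv-wk (Δ `, A) o {s ▸ t} (r , q) = GluedEnv-wk Δ o r , Glued-wk A o q
GluedEnv-wk (Δ ,🔒) o (glued e r) = glued _ (GluedEnv-wk Δ _ r)

lookup-Glued : ∀ {Δ A Γ} (v : Δ ∋ A) {s : Γ ⊢s Δ} {ρ} → GluedEnv Δ s ρ → Glued A (substVar v s) (lookup v ρ)
lookup-Glued zero {s ▸ t} (r , q) = q
lookup-Glued (succ v) {s ▸ t} (r , q) = lookup-Glued v r

unlockEnv-Glued : ∀ {Δ Ξ Γ} (e : Ξ ◁ Δ) {s : Γ ⊢s Δ} {ρ} → GluedEnv Δ s ρ →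
  GluedLock (GluedEnv Ξ) (lock (sub (factorSub s e)) (acc (factorSub s e))) (unlockEnv e ρ)
unlockEnv-Glued nil (glued e r) = glued e r
unlockEnv-Glued (ext e) {s ▸ t} (r , q) = unlockEnv-Glued e r

wk-factor-unbox : ∀ {Γ Δ A} (e : Δ ◁ Γ) (t : Δ ⊢ (□ A)) → wk (factor e) (unbox t nil) ≡ unbox t e
wk-factor-unbox e t rewrite factorOPE-factor e = cong (λ x → unbox x e) (wk-id t)

fundamental : ∀ {Δ A Γ} (t : Δ ⊢ A) {s : Γ ⊢s Δ} {ρ} → GluedEnv Δ s ρ → Glued A (t [ s ]) (eval t ρ)
fundamental (var v) r = lookup-Glued v r
fundamental {Δ} {A ⇒ B} (lam t) {s} r = λ o {u} q →
  Glued-≈ B (≈-sym (β-wk-sub o t s u)) (fundamental t (GluedEnv-wk Δ o r , q))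
fundamental {A = B} (app t u) {s} r =
  Glued-≈ B (cong-app (≡⇒≈ (wk-id (t [ s ]))) ≈-refl) (fundamental t r idOPE (fundamental u r))
fundamental {A = □ A} (box t) r =
  Glued-≈ A (≈-sym (≈-trans (□-β _ nil) (≡⇒≈ (wk-id _)))) (fundamental t (glued nil r))
fundamental {A = A} (unbox {Δ = Ξ} t e) r = unbox-Glued (unlockEnv-Glued e r)
  where
  unbox-Glued : ∀ {Γ Θ} {s : Θ ⊢s Ξ} {e' : Θ ◁ Γ} {f} → GluedLock (GluedEnv Ξ) (lock s e') f →
    Glued A (unbox (t [ s ]) e') (unboxVal t f)
  unbox-Glued (glued e' r') = Glued-≈ A (≡⇒≈ (wk-factor-unbox e' _)) (Glued-wk A (factor e') (fundamental t r'))

GluedEnv-id : ∀ {Γ} → GluedEnv Γ idSub idEnv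
GluedEnv-id {·} = tt
GluedEnv-id {Γ `, A} = GluedEnv-wk Γ (drop idOPE) GluedEnv-id , Glued-reflect A (var zero)
GluedEnv-id {Γ ,🔒} = glued nil GluedEnv-id

≈-embNf-nf : ∀ {Γ A} (t : Γ ⊢ A) → t ≈ embNf (nf t)
≈-embNf-nf {A = A} t = subst (_≈ embNf (nf t)) (sub-id t) (Glued-reify A (fundamental t GluedEnv-id))

theorem4p5 : ∀ {Γ A} (t u : Γ ⊢ A) → Dec (t ≈ u)
theorem4p5 t u = map′ nf-equal⇒≈ nf-cong (nf t ≟Nf nf u)
  where
  nf-equal⇒≈ : nf t ≡ nf u → t ≈ u
  nf-equal⇒≈ eq = ≈-trans (≈-embNf-nf t) (≈-trans (≡⇒≈ (cong embNf eq)) (≈-sym (≈-embNf-nf u)))
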